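{- Let $X$ be a robust $X$-set parameter and let $\mathcal{B}_X$ be an inclusive component consistent $X$-irredundant blocking family for $X$. Then $\operatorname{XIR}$ (the parameter whose $Y$-sets are the XIr-sets for $\mathcal{B}_X$) is a robust $Y$-set parameter; that is: (a) every graph has an XIr-set and every subset of an XIr-set is an XIr-set; (b) for every graph $G$ with connected components $G_1,\dots,G_k$, $S\subseteq V(G)$ is an XIr-set of $G$ if and only if $S\cap V(G_i)$ is an XIr-set of $G_i$ for each $i$; (c) if $G$ is connected of order at least two, every singleton $\{v\}\subseteq V(G)$ is an XIr-set of $G$.
   Context: Graphs are finite, simple, with nonempty vertex set. A super $X$-set parameter $X$ is specified by an isomorphism-invariant property of vertex subsets (the $X$-sets) such that every graph has an $X$-set and supersets of $X$-sets are $X$-sets. $X$ is component consistent if for every graph $G$ with components $G_1,\dots,G_k$, $S$ is an $X$-set of $G$ iff $S\cap V(G_i)$ is an $X$-set of $G_i$ for each $i$; $X$ is robust if moreover, for every connected graph of order $n\ge 2$, every set of $n-1$ vertices is an $X$-set. $R\subseteq V(G)$ is an $X$-blocking set if $V(G)\setminus R$ is not an $X$-set. An $X$-blocking family $\mathcal{B}_X$ assigns to each graph $G$ a set $B_X(G)$ of $X$-blocking sets, compatibly with isomorphism. It is $X$-irredundant if for every $G$ and $S\subseteq V(G)$: $S$ is an $X$-set iff $S\cap R\ne\emptyset$ for all $R\in B_X(G)$. It is component consistent if for every $G$ with components $G_1,\dots,G_k$: (1) $R_i\in B_X(G_i)\Rightarrow R_i\in B_X(G)$; (2) $R\in B_X(G)\Rightarrow$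 for each $i$, $R\cap V(G_i)\in B_X(G_i)$ or $R\cap V(G_i)=\emptyset$. It is inclusive if for every connected $G$ of order at least two and $v\in V(G)$ there is $R\in B_X(G)$ with $v\in R$. $S\subseteq V(G)$ is an XIr-set if for every $u\in S$ there is $R\in B_X(G)$ with $S\cap R=\{u\}$; $\operatorname{XIR}(G)$ is the maximum cardinality of an XIr-set. -}

module Defs where

open import Data.Nat using (ℕ; zero; suc)
open import Data.Fin using (Fin; zero)
open import Data.Bool using (Bool; true; false)
open import Data.Vec using (tabulate; lookup)
open import Data.Fin.Subset using (Subset; _∈_; _⊆_; ∣_∣; _∩_; ∁; ⁅_⁆; Nonempty; Empty)
open import Data.Product using (Σ; ∃; _×_; _,_)
open import Data.Sum using (_⊎_)
open import Relation.Nullary using (¬_)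
open import Relation.Binary.PropositionalEquality using (_≡_)
open import Function.Definitions using (Injective)

-- Finite simple graphs on the vertex set Fin n.
-- (Graphs of the paper have nonempty vertex set; we always use Graph (suc n).)

record Graph (n : ℕ) : Set where
  field
    adj    : Fin n → Fin n → Bool
    sym    : ∀ i j → adj i j ≡ adj j i
    irrefl : ∀ i → adj i i ≡ false
open Graph public

data Reach {n} (G : Graph n) : Fin n → Fin n → Set where
  here : ∀ {u} → Reach G u u
  step : ∀ {u w v} → adj G u w ≡ true → Reach G w v → Reach G u v

Connected : ∀ {n} → Graph n → Set
Connected G = ∀ u v → Reach G u v

preimage : ∀ {m n} → (Fin m → Fin n) → Subset n → Subset m
preimage e S = tabulate (λ i → lookup S (e i))

induced : ∀ {m n} → Graph n → (Fin m → Fin n) → Graph m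
induced G e = record
  { adj    = λ i j → adj G (e i) (e j)
  ; sym    = λ i j → sym G (e i) (e j)
  ; irrefl = λ i → irrefl G (e i)
  }

-- e : Fin (suc m) → Fin n identifies a connected component of G:
-- e is injective and its image is exactly the set of vertices reachable
-- from e zero.  The component G_i is then  induced G e , and for
-- S ⊆ V(G), S ∩ V(G_i) corresponds to  preimage e S .
record IsComponent {m n} (G : Graph n) (e : Fin (suc m) → Fin n) : Set where
  field
    injective : Injective _≡_ _≡_ e
    reach     : ∀ i → Reach G (e zero) (e i)
    closed    : ∀ v → Reach G (e zero) v → ∃ λ i → e i ≡ v
open IsComponent public

-- Graph isomorphism given by an injective (hence bijective) vertex map
record IsIso {n} (G G′ : Graph n) (σ : Fin n → Fin n) : Set where
  field
    injective : Injective _≡_ _≡_ σ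
    preserves : ∀ i j → adj G′ (σ i) (σ j) ≡ adj G i j
open IsIso public

-- Vertex-subset properties of (nonempty) graphs: used both for
-- parameters X (S is an X-set) and for blocking families (R ∈ B_X(G)).

SetProp : Set₁
SetProp = ∀ {n} → Graph (suc n) → Subset (suc n) → Set

IsoInvariant : SetProp → Set
IsoInvariant P = ∀ {n} (G G′ : Graph (suc n)) (σ : Fin (suc n) → Fin (suc n)) →
  IsIso G G′ σ → ∀ S′ → (P G′ S′ → P G (preimage σ S′)) × (P G (preimage σ S′) → P G′ S′)

record SuperXSetParameter (X : SetProp) : Set where
  field
    isoInv   : IsoInvariant X
    existsX  : ∀ {n} (G : Graph (suc n)) → ∃ λ S → X G S
    superset : ∀ {n} (G : Graph (suc n)) S T → X G S → S ⊆ T → X G T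

ComponentConsistent : SetProp → Set
ComponentConsistent X = ∀ {n} (G : Graph (suc n)) S →
  (X G S → ∀ m (e : Fin (suc m) → Fin (suc n)) → IsComponent G e → X (induced G e) (preimage e S))
  × ((∀ m (e : Fin (suc m) → Fin (suc n)) → IsComponent G e → X (induced G e) (preimage e S)) → X G S)

record Robust (X : SetProp) : Set where
  field
    super      : SuperXSetParameter X
    compCons   : ComponentConsistent X
    allButOne  : ∀ {m} (G : Graph (suc (suc m))) → Connected G →
                   ∀ S → ∣ S ∣ ≡ suc m → X G S

record BlockingFamily (X B : SetProp) : Set where
  field
    isoInv   : IsoInvariant B
    blocking : ∀ {n} (G : Graph (suc n)) R → B G R → ¬ X G (∁ R)

Irredundant : SetProp → SetProp → Set
Irredundant X B = ∀ {n} (G : Graph (suc n)) S →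
  (X G S → ∀ R → B G R → Nonempty (S ∩ R)) × ((∀ R → B G R → Nonempty (S ∩ R)) → X G S)

-- Component consistency of a blocking family.
-- (1): R_i ∈ B(G_i), viewed as a subset of V(G), lies in B(G);
--      the subset of V(G) corresponding to R_i is the R ⊆ image(e) with preimage e R = R_i.
-- (2): R ∈ B(G) ⇒ R ∩ V(G_i) ∈ B(G_i) or R ∩ V(G_i) = ∅.
record ComponentConsistentFamily (B : SetProp) : Set where
  field
    lift     : ∀ {n} (G : Graph (suc n)) m (e : Fin (suc m) → Fin (suc n)) → IsComponent G e →
                 ∀ R → (∀ v → v ∈ R → ∃ λ i → e i ≡ v) →
                 B (induced G e) (preimage e R) → B G R
    restrict : ∀ {n} (G : Graph (suc n)) R → B G R →
                 ∀ m (e : Fin (suc m) → Fin (suc n)) → IsComponent G e →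
                 B (induced G e) (preimage e R) ⊎ Empty (preimage e R)

Inclusive : SetProp → Set
Inclusive B = ∀ {m} (G : Graph (suc (suc m))) → Connected G →
  ∀ v → ∃ λ R → B G R × v ∈ R

XIr : SetProp → SetProp
XIr B G S = ∀ u → u ∈ S → ∃ λ R → B G R × (S ∩ R ≡ ⁅ u ⁆)

-- Call a blocking set R private for u in S if S ∩ R = {u}. The empty set is trivially an
-- XIr-set, and XIr-sets are closed under subsets because a private blocking set for u in T
-- stays private for u in any S ⊆ T containing u. Inclusiveness puts every
-- vertex of a connected graph into some blocking set, which is then private for the
-- singleton. Component consistency transfers private blocking sets both ways: restricting
-- one to the component of u keeps it nonempty (it contains u), hence a blocking set there;
-- conversely a private blocking set of u in the component of u lifts to G, where it can
-- meet S only inside that component. The only real work is to show that every vertex lies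
-- in a component, i.e. that the set of vertices reachable from it is computable; it is
-- obtained by saturating {u} under adjacency, which terminates since subsets only grow.
module Submission where

open import Defs hiding (sym)
open import Data.Nat using (suc)
open import Data.Fin using (Fin; zero; suc)
open import Data.Fin.Properties using (any?; suc-injective) renaming (_≟_ to _≟ᶠ_)
open import Data.Fin.Subset using (Subset; _⊆_; _⊂_; _⊃_; ⁅_⁆; _∈_; _∩_; ∣_∣; Nonempty; ⊥)
open import Data.Fin.Subset.Properties
  using (∉⊥; x∈⁅x⁆; x∈⁅y⁆⇒x≡y; ⊆-antisym; x∈p∩q⁺; x∈p∩q⁻; _⊂?_; _∈?_)
open import Data.Fin.Subset.Induction using (Acc; acc; ⊃-wellFounded)
open import Data.Bool using (true; false)
open import Data.Bool.Properties using () renaming (_≟_ to _≟ᵇ_)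
open import Data.Vec using (_∷_; tabulate; here; there)
open import Data.Vec.Properties using (lookup∘tabulate; []=⇒lookup; lookup⇒[]=)
open import Data.Product using (∃; Σ; _×_; _,_; proj₁; proj₂)
open import Data.Sum using (_⊎_; inj₁; inj₂)
open import Relation.Nullary using (¬_; Dec; yes; no; does; contradiction)
open import Relation.Nullary.Decidable using (_×-dec_; _⊎-dec_; dec-true)
open import Relation.Unary using (Decidable)
open import Relation.Binary.PropositionalEquality using (_≡_; refl; cong; subst; trans; sym)
open import Function.Base using (id; _∘_)
open import Function.Definitions using (Injective)

module _ {n} {G : Graph n} where

  Reach-snoc : ∀ {u v w} → Reach G u v → adj G v w ≡ true → Reach G u w
  Reach-snoc here      vw = step vw here
  Reach-snoc (step e r) vw = step e (Reach-snoc r vw)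

  Reach-sym : ∀ {u v} → Reach G u v → Reach G v u
  Reach-sym here                 = here
  Reach-sym (step {u} {w} uw r) = Reach-snoc (Reach-sym r) (trans (Graph.sym G w u) uw)

  Reach-trans : ∀ {u v w} → Reach G u v → Reach G v w → Reach G u w
  Reach-trans here       r′ = r′
  Reach-trans (step e r) r′ = step e (Reach-trans r r′)

module _ {n} {P : Fin n → Set} (P? : Decidable P) where

  subsetOf : Subset n
  subsetOf = tabulate (λ v → does (P? v))

  ∈-subsetOf⁺ : ∀ {v} → P v → v ∈ subsetOf
  ∈-subsetOf⁺ {v} p = lookup⇒[]= v _ (trans (lookup∘tabulate _ v) (dec-true (P? v) p))

  ∈-subsetOf⁻ : ∀ {v} → v ∈ subsetOf → P v
  ∈-subsetOf⁻ {v} h with P? v | trans (sym (lookup∘tabulate _ v)) ([]=⇒lookup h)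
  ... | yes p | _ = p

module _ {m n} (e : Fin m → Fin n) (S : Subset n) where

  ∈-preimage⁺ : ∀ {i} → e i ∈ S → i ∈ preimage e S
  ∈-preimage⁺ {i} h = lookup⇒[]= i _ (trans (lookup∘tabulate _ i) ([]=⇒lookup h))

  ∈-preimage⁻ : ∀ {i} → i ∈ preimage e S → e i ∈ S
  ∈-preimage⁻ {i} h = lookup⇒[]= (e i) S (trans (sym (lookup∘tabulate _ i)) ([]=⇒lookup h))

module _ {m n} (e : Fin m → Fin n) where

  private
    hits? : ∀ R → Decidable (λ v → ∃ λ i → e i ≡ v × i ∈ R)
    hits? R v = any? (λ i → (e i ≟ᶠ v) ×-dec (i ∈? R))

  image : Subset m → Subset n
  image R = subsetOf (hits? R)

  ∈-image⁺ : ∀ {R i} → i ∈ R → e i ∈ image R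
  ∈-image⁺ {R} i∈R = ∈-subsetOf⁺ (hits? R) (_ , refl , i∈R)

  ∈-image⁻ : ∀ {R v} → v ∈ image R → ∃ λ i → e i ≡ v × i ∈ R
  ∈-image⁻ {R} = ∈-subsetOf⁻ (hits? R)

  preimage-image : Injective _≡_ _≡_ e → ∀ R → preimage e (image R) ≡ R
  preimage-image inj R = ⊆-antisym ⊆R (∈-preimage⁺ e (image R) ∘ ∈-image⁺)
    where
    ⊆R : preimage e (image R) ⊆ R
    ⊆R h with ∈-image⁻ (∈-preimage⁻ e (image R) h)
    ... | i , eᵢ≡ , i∈R = subst (_∈ R) (inj eᵢ≡) i∈R

record MeetExactlyAt {n} (S R : Subset n) (u : Fin n) : Set where
  field
    ∈ˡ     : u ∈ S
    ∈ʳ     : u ∈ R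
    unique : ∀ {x} → x ∈ S → x ∈ R → x ≡ u
open MeetExactlyAt

module _ {n} {S R : Subset n} {u : Fin n} where

  ∩≡⁅⁆⇒MeetExactlyAt : S ∩ R ≡ ⁅ u ⁆ → MeetExactlyAt S R u
  ∩≡⁅⁆⇒MeetExactlyAt eq = record
    { ∈ˡ     = proj₁ (x∈p∩q⁻ S R u∈S∩R)
    ; ∈ʳ     = proj₂ (x∈p∩q⁻ S R u∈S∩R)
    ; unique = λ x∈S x∈R → x∈⁅y⁆⇒x≡y u (subst (_ ∈_) eq (x∈p∩q⁺ (x∈S , x∈R)))
    }
    where
    u∈S∩R : u ∈ S ∩ R
    u∈S∩R = subst (u ∈_) (sym eq) (x∈⁅x⁆ u)

  MeetExactlyAt⇒∩≡⁅⁆ : MeetExactlyAt S R u → S ∩ R ≡ ⁅ u ⁆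
  MeetExactlyAt⇒∩≡⁅⁆ m = ⊆-antisym
    (λ h → let (x∈S , x∈R) = x∈p∩q⁻ S R h in subst (_∈ ⁅ u ⁆) (sym (unique m x∈S x∈R)) (x∈⁅x⁆ u))
    (λ h → subst (_∈ S ∩ R) (sym (x∈⁅y⁆⇒x≡y u h)) (x∈p∩q⁺ (∈ˡ m , ∈ʳ m)))

record Enumerates {m n} (p : Subset n) (e : Fin m → Fin n) : Set where
  field
    injective : Injective _≡_ _≡_ e
    sound     : ∀ i → e i ∈ p
    complete  : ∀ {v} → v ∈ p → ∃ λ i → e i ≡ v

enum : ∀ {n} (p : Subset n) → Fin ∣ p ∣ → Fin n
enum (true  ∷ p) zero    = zero
enum (true  ∷ p) (suc i) = suc (enum p i)
enum (false ∷ p) i       = suc (enum p i)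

enum-enumerates : ∀ {n} (p : Subset n) → Enumerates p (enum p)
enum-enumerates p = record { injective = inj p ; sound = sound p ; complete = complete p }
  where
  inj : ∀ {n} (p : Subset n) → Injective _≡_ _≡_ (enum p)
  inj (true  ∷ p) {zero}  {zero}  _  = refl
  inj (true  ∷ p) {suc i} {suc j} eq = cong suc (inj p (suc-injective eq))
  inj (false ∷ p) eq                 = inj p (suc-injective eq)

  sound : ∀ {n} (p : Subset n) i → enum p i ∈ p
  sound (true  ∷ p) zero    = here
  sound (true  ∷ p) (suc i) = there (sound p i)
  sound (false ∷ p) i       = there (sound p i)

  complete : ∀ {n} (p : Subset n) {v} → v ∈ p → ∃ λ i → enum p i ≡ v
  complete (true  ∷ p) here = zero , refl
  complete (true  ∷ p) (there h) with complete p h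
  ... | i , eq = suc i , cong suc eq
  complete (false ∷ p) (there h) with complete p h
  ... | i , eq = i , cong suc eq

enumerate : ∀ {n} (p : Subset n) → Nonempty p →
            ∃ λ m → Σ (Fin (suc m) → Fin n) (Enumerates p)
enumerate {n} p (v , v∈p) = shift (proj₁ (Enumerates.complete (enum-enumerates p) v∈p))
  where
  shift : Fin ∣ p ∣ → ∃ λ m → Σ (Fin (suc m) → Fin n) (Enumerates p)
  shift i with ∣ p ∣ | enum p | enum-enumerates p
  ... | suc m | e | enumerates = m , e , enumerates

module _ {n} (G : Graph n) where

  ClosedUnderAdj : Subset n → Set
  ClosedUnderAdj C = ∀ {v w} → v ∈ C → adj G v w ≡ true → w ∈ C

  Reach-closed : ∀ {C} → ClosedUnderAdj C → ∀ {v w} → Reach G v w → v ∈ C → w ∈ C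
  Reach-closed closed here       v∈C = v∈C
  Reach-closed closed (step e r) v∈C = Reach-closed closed r (closed v∈C e)

  private
    adjacentTo? : ∀ C → Decidable (λ w → ∃ λ v → v ∈ C × adj G v w ≡ true)
    adjacentTo? C w = any? (λ v → (v ∈? C) ×-dec (adj G v w ≟ᵇ true))

    inExpansion? : ∀ C w → Dec (w ∈ C ⊎ ∃ λ v → v ∈ C × adj G v w ≡ true)
    inExpansion? C w = (w ∈? C) ⊎-dec adjacentTo? C w

  expand : Subset n → Subset n
  expand C = subsetOf (inExpansion? C)

  ⊆-expand : ∀ {C} → C ⊆ expand C
  ⊆-expand {C} w∈C = ∈-subsetOf⁺ (inExpansion? C) (inj₁ w∈C)

  ⊄expand⇒closed : ∀ {C} → ¬ C ⊂ expand C → ClosedUnderAdj C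
  ⊄expand⇒closed {C} C⊄ {v} {w} v∈C vw with w ∈? C
  ... | yes w∈C = w∈C
  ... | no  w∉C = contradiction ((λ {x} → ⊆-expand {C} {x}) , w , w∈expand , w∉C) C⊄
    where w∈expand = ∈-subsetOf⁺ (inExpansion? C) (inj₂ (v , v∈C , vw))

  module _ {u : Fin n} where

    expand-reach : ∀ {C} → (∀ {w} → w ∈ C → Reach G u w) → ∀ {w} → w ∈ expand C → Reach G u w
    expand-reach {C} reach h with ∈-subsetOf⁻ (inExpansion? C) h
    ... | inj₁ w∈C             = reach w∈C
    ... | inj₂ (v , v∈C , vw) = Reach-snoc (reach v∈C) vw

    -- Expanding terminates because a strictly growing chain of subsets of Fin n is finite.
    saturation : ∀ C → Acc _⊃_ C → (∀ {w} → w ∈ C → Reach G u w) →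
                 Σ (Subset n) λ D → C ⊆ D × ClosedUnderAdj D × (∀ {w} → w ∈ D → Reach G u w)
    saturation C (acc rec) reach with C ⊂? expand C
    ... | no  C⊄ = C , id , ⊄expand⇒closed C⊄ , reach
    ... | yes C⊂ with saturation (expand C) (rec C⊂) (expand-reach reach)
    ...   | D , C′⊆D , closed , reachD = D , C′⊆D ∘ ⊆-expand , closed , reachD

  private
    reachable-saturation : ∀ u → Σ (Subset n) λ D →
      ⁅ u ⁆ ⊆ D × ClosedUnderAdj D × (∀ {w} → w ∈ D → Reach G u w)
    reachable-saturation u = saturation ⁅ u ⁆ (⊃-wellFounded ⁅ u ⁆) (reach-⁅⁆ ∘ x∈⁅y⁆⇒x≡y u)
      where
      reach-⁅⁆ : ∀ {w} → w ≡ u → Reach G u w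
      reach-⁅⁆ refl = here

  reachable : Fin n → Subset n
  reachable u = proj₁ (reachable-saturation u)

  ∈-reachable⁺ : ∀ {u w} → Reach G u w → w ∈ reachable u
  ∈-reachable⁺ {u} r with reachable-saturation u
  ... | _ , ⁅u⁆⊆D , closed , _ = Reach-closed closed r (⁅u⁆⊆D (x∈⁅x⁆ u))

  ∈-reachable⁻ : ∀ {u w} → w ∈ reachable u → Reach G u w
  ∈-reachable⁻ {u} = proj₂ (proj₂ (proj₂ (reachable-saturation u)))

component-containing : ∀ {n} (G : Graph n) u →
  ∃ λ m → Σ (Fin (suc m) → Fin n) λ e → IsComponent G e × ∃ λ i → e i ≡ u
component-containing G u with enumerate (reachable G u) (u , ∈-reachable⁺ G here)
... | m , e , enumerates = m , e , isComponent , complete (reach⁺ here)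
  where
  open Enumerates enumerates using (sound; complete)
  reach⁺ : ∀ {w} → Reach G u w → w ∈ reachable G u
  reach⁺ = ∈-reachable⁺ G
  reach⁻ : ∀ {w} → w ∈ reachable G u → Reach G u w
  reach⁻ = ∈-reachable⁻ G
  isComponent : IsComponent G e
  isComponent = record
    { injective = Enumerates.injective enumerates
    ; reach     = λ i → Reach-trans (Reach-sym (reach⁻ (sound zero))) (reach⁻ (sound i))
    ; closed    = λ v r → complete (reach⁺ (Reach-trans (reach⁻ (sound zero)) r))
    }

module _ (B : SetProp) where

  XIr-∅ : ∀ {n} (G : Graph (suc n)) → XIr B G ⊥
  XIr-∅ G u u∈∅ = contradiction u∈∅ ∉⊥

  XIr-⊆ : ∀ {n} (G : Graph (suc n)) (S T : Subset (suc n)) → XIr B G T → S ⊆ T → XIr B G S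
  XIr-⊆ G S T xirT S⊆T u u∈S with xirT u (S⊆T u∈S)
  ... | R , R∈B , T∩R≡u = R , R∈B , MeetExactlyAt⇒∩≡⁅⁆ (record
    { ∈ˡ     = u∈S
    ; ∈ʳ     = ∈ʳ meet
    ; unique = λ x∈S x∈R → unique meet (S⊆T x∈S) x∈R
    })
    where meet = ∩≡⁅⁆⇒MeetExactlyAt T∩R≡u

  XIr-⁅⁆ : Inclusive B → ∀ {m} (G : Graph (suc (suc m))) → Connected G → ∀ v → XIr B G ⁅ v ⁆
  XIr-⁅⁆ inclusive G connected v u u∈⁅v⁆ with inclusive G connected u
  ... | R , R∈B , u∈R = R , R∈B , MeetExactlyAt⇒∩≡⁅⁆ (record
    { ∈ˡ     = u∈⁅v⁆
    ; ∈ʳ     = u∈R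
    ; unique = λ x∈⁅v⁆ _ → trans (x∈⁅y⁆⇒x≡y v x∈⁅v⁆) (sym (x∈⁅y⁆⇒x≡y v u∈⁅v⁆))
    })

  module _ (ccf : ComponentConsistentFamily B) where
    open ComponentConsistentFamily ccf

    XIr-restrict : ∀ {n} (G : Graph (suc n)) S → XIr B G S →
                   ∀ m (e : Fin (suc m) → Fin (suc n)) → IsComponent G e →
                   XIr B (induced G e) (preimage e S)
    XIr-restrict G S xirS m e component i i∈S′ with xirS (e i) (∈-preimage⁻ e S i∈S′)
    ... | R , R∈B , S∩R≡eᵢ with ∩≡⁅⁆⇒MeetExactlyAt S∩R≡eᵢ
    ...   | meet with restrict G R R∈B m e component
    ...     | inj₂ R′-empty = contradiction (i , ∈-preimage⁺ e R (∈ʳ meet)) R′-empty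
    ...     | inj₁ R′∈B = preimage e R , R′∈B , MeetExactlyAt⇒∩≡⁅⁆ (record
      { ∈ˡ     = i∈S′
      ; ∈ʳ     = ∈-preimage⁺ e R (∈ʳ meet)
      ; unique = λ x∈S′ x∈R′ →
          IsComponent.injective component (unique meet (∈-preimage⁻ e S x∈S′) (∈-preimage⁻ e R x∈R′))
      })

    XIr-extend : ∀ {n} (G : Graph (suc n)) S →
                 (∀ m (e : Fin (suc m) → Fin (suc n)) → IsComponent G e → XIr B (induced G e) (preimage e S)) →
                 XIr B G S
    XIr-extend G S xirComponents u u∈S with component-containing G u
    ... | m , e , component , i , refl with xirComponents m e component i (∈-preimage⁺ e S u∈S)
    ...   | R′ , R′∈B , S′∩R′≡i = image e R′ , R∈B , MeetExactlyAt⇒∩≡⁅⁆ (record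
      { ∈ˡ     = u∈S
      ; ∈ʳ     = ∈-image⁺ e (∈ʳ meet)
      ; unique = unique′
      })
      where
      meet = ∩≡⁅⁆⇒MeetExactlyAt S′∩R′≡i
      R∈B : B G (image e R′)
      R∈B = lift G m e component (image e R′) (λ _ v∈R → let (k , eₖ≡v , _) = ∈-image⁻ e v∈R in k , eₖ≡v)
              (subst (B (induced G e)) (sym (preimage-image e (IsComponent.injective component) R′)) R′∈B)
      unique′ : ∀ {x} → x ∈ S → x ∈ image e R′ → x ≡ e i
      unique′ x∈S x∈R with ∈-image⁻ e x∈R
      ... | k , refl , k∈R′ = cong e (unique meet (∈-preimage⁺ e S x∈S) k∈R′)

    XIr-componentConsistent : ComponentConsistent (XIr B)
    XIr-componentConsistent G S = XIr-restrict G S , XIr-extend G S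


theorem2p17 : (X B : SetProp) → Robust X → BlockingFamily X B → Inclusive B →
    ComponentConsistentFamily B → Irredundant X B →
    ((∀ {n} (G : Graph (suc n)) → ∃ λ S → XIr B G S)
      × (∀ {n} (G : Graph (suc n)) (S T : Subset (suc n)) → XIr B G T → S ⊆ T → XIr B G S))
    × ComponentConsistent (XIr B)
    × (∀ {m} (G : Graph (suc (suc m))) → Connected G → ∀ v → XIr B G ⁅ v ⁆)
theorem2p17 _ B _ _ inclusive ccf _ =
    ((λ G → ⊥ , XIr-∅ B G) , XIr-⊆ B)
  , XIr-componentConsistent B ccf
  , XIr-⁅⁆ B inclusive
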